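{- For every sequence of primes $p_1,\dots,p_h$ there exists a finite solvable Malcev algebra $\mathbf A$ such that $\mathrm{nuDet}_{p_1}\circ\dots\circ\mathrm{nuDet}_{p_h}\subseteq\mathrm{nuP}_{\mathbf A}$.
   Context: An ABP over $\mathrm{GF}(p)$ is a DAG with one source and one sink, edges labelled by variables or constants; it computes the sum over source-sink paths of products of labels; size = vertices plus edges. A $\mathrm{BABP}_p$ gate is labelled by an ABP over $\mathrm{GF}(p)$ and a set $T\subseteq\mathrm{GF}(p)$, outputs 1 iff the polynomial evaluated on its Boolean inputs lies in $T$, and has the size of its ABP. $\mathrm{nuDet}_{p_1}\circ\dots\circ\mathrm{nuDet}_{p_h}$ is the class of languages recognized by polynomial-size layered circuits with output gate $\mathrm{BABP}_{p_1}$, fed by $\mathrm{BABP}_{p_2}$ gates, ..., with $\mathrm{BABP}_{p_h}$ gates reading the input bits (size = edges plus sum of gate sizes). For a finite algebra $\mathbf A$, $\mathrm{nuP}_{\mathbf A}$ is the class of languages over $\{0,1\}$ recognized by NuDFAs $((t_n),\iota,S)$ with $t_n$ $n$-input circuits over $\mathbf A$ (sources variables or constants, gates basic operations) of polynomially bounded size, $\iota:\{0,1\}\to A$, $S\subseteq A$, accepting $b$ iff $t_n(\iota(b_1),\dots,\iota(b_n))\in S$. Malcev: has a term $d$ with $d(x,y,y)=d(y,y,x)=x$; solvable in the commutator-theory sense. -}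

module Defs where

open import Data.Nat using (ℕ; zero; suc; _+_; _*_; _^_; _≤_; _<_)
open import Data.Nat.DivMod using (_mod_)
open import Data.Fin using (Fin; toℕ; fromℕ; _≟_) renaming (zero to fzero; suc to fsuc)
open import Data.Bool using (Bool; true; false; if_then_else_)
open import Data.List using (List; []; _∷_; length)
open import Data.List.Relation.Unary.Any using (Any)
open import Data.Vec using (Vec; []; _∷_; lookup)
open import Data.Sum using (_⊎_; inj₁; inj₂; [_,_])
open import Data.Product using (Σ; _×_; ∃)
open import Data.Unit using (⊤)
open import Relation.Nullary using (¬_; does)
open import Relation.Binary.PropositionalEquality using (_≡_)
open import Function.Bundles using (_⇔_)

ΣFin : (m : ℕ) → (Fin m → ℕ) → ℕ
ΣFin zero    f = 0
ΣFin (suc m) f = f fzero + ΣFin m (λ i → f (fsuc i))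

sumUpTo : ℕ → (ℕ → ℕ) → ℕ
sumUpTo zero    f = f 0
sumUpTo (suc V) f = f (suc V) + sumUpTo V f

bit : Bool → ℕ
bit true  = 1
bit false = 0

PolyBounded : (ℕ → ℕ) → Set
PolyBounded s = Σ ℕ λ c → Σ ℕ λ k → (n : ℕ) → s n ≤ c * (n ^ k) + c

Lang : Set₁
Lang = (n : ℕ) → (Fin n → Bool) → Set

-- GF(p) is represented by Fin p (residues); the polynomial is evaluated
-- in ℕ (a semiring homomorphically mapping onto ℤ/p) and reduced mod p.

data Label (p k : ℕ) : Set where
  lvar   : Fin k → Label p k
  lconst : Fin p → Label p k

labelVal : ∀ {p k} → (Fin k → Bool) → Label p k → ℕ
labelVal ρ (lvar i)   = bit (ρ i)
labelVal ρ (lconst c) = toℕ c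

-- vertices are Fin (suc V); every edge goes forward in this numbering
-- (a topological order), so the graph is a DAG.
record Edge (p k V : ℕ) : Set where
  field
    from    : Fin (suc V)
    to      : Fin (suc V)
    forward : toℕ from < toℕ to
    label   : Label p k

-- source = vertex 0, sink = vertex V; these are the unique source and
-- unique sink of the DAG.
record ABP (p k : ℕ) : Set where
  field
    V       : ℕ
    edges   : List (Edge p k V)
    onlySource : (v : Fin (suc V)) → ¬ (v ≡ fzero) → Any (λ e → Edge.to e ≡ v) edges
    onlySink   : (v : Fin (suc V)) → ¬ (v ≡ fromℕ V) → Any (λ e → Edge.from e ≡ v) edges

abpSize : ∀ {p k} → ABP p k → ℕ
abpSize A = suc (ABP.V A) + length (ABP.edges A)

module _ {p k V : ℕ} (es : List (Edge p k V)) (ρ : Fin k → Bool) where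
  -- walkSum j u = sum over paths with exactly j edges from u to the sink
  -- of the product of their labels
  walkSum : ℕ → Fin (suc V) → ℕ
  stepSum : ℕ → Fin (suc V) → List (Edge p k V) → ℕ
  walkSum zero    u = if does (u ≟ fromℕ V) then 1 else 0
  walkSum (suc j) u = stepSum j u es
  stepSum j u []       = 0
  stepSum j u (e ∷ fs) =
    (if does (Edge.from e ≟ u) then labelVal ρ (Edge.label e) * walkSum j (Edge.to e) else 0)
    + stepSum j u fs

-- value (in ℕ, before reduction mod p) of the polynomial computed by the ABP:
-- sum over all source-sink paths (they have at most V edges)
abpVal : ∀ {p k} → ABP p k → (Fin k → Bool) → ℕ
abpVal A ρ = sumUpTo (ABP.V A) (λ j → walkSum (ABP.edges A) ρ j fzero)

inT : (p : ℕ) → (Fin p → Bool) → ℕ → Bool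
inT zero    T v = false
inT (suc q) T v = T (v mod suc q)

record Gate (p m : ℕ) : Set where
  field
    arity : ℕ
    wire  : Fin arity → Fin m
    abp   : ABP p arity
    T     : Fin p → Bool

gateEval : ∀ {p m} → Gate p m → (Fin m → Bool) → Bool
gateEval {p} g ρ = inT p (Gate.T g) (abpVal (Gate.abp g) (λ i → ρ (Gate.wire g i)))

gateSize : ∀ {p m} → Gate p m → ℕ
gateSize g = Gate.arity g + abpSize (Gate.abp g)

-- Stack n ps m : layered circuit on n input bits whose layers, from top to
-- bottom, use primes ps, with m gates in the top layer; the bottom layer
-- reads the input bits.
data Stack (n : ℕ) : List ℕ → ℕ → Set where
  inputs : Stack n [] n
  layer  : ∀ {ps k} (p m : ℕ) → (Fin m → Gate p k) → Stack n ps k → Stack n (p ∷ ps) m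

evalStack : ∀ {n ps m} → Stack n ps m → (Fin n → Bool) → Fin m → Bool
evalStack inputs          w = w
evalStack (layer p m g s) w = λ i → gateEval (g i) (evalStack s w)

stackSize : ∀ {n ps m} → Stack n ps m → ℕ
stackSize inputs          = 0
stackSize (layer p m g s) = ΣFin m (λ i → gateSize (g i)) + stackSize s

-- L ∈ nuDet_{p} ∘ nuDet_{p_2} ∘ ... (single output gate BABP_p)
InNuDet : ℕ → List ℕ → Lang → Set
InNuDet p ps L =
  Σ ((n : ℕ) → Stack n (p ∷ ps) 1) λ C →
    PolyBounded (λ n → stackSize (C n)) ×
    ((n : ℕ) (w : Fin n → Bool) → L n w ⇔ (evalStack (C n) w fzero ≡ true))

record FinAlg : Set where
  field
    size  : ℕ
    nops  : ℕ
    arity : Fin nops → ℕ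
    op    : (f : Fin nops) → (Fin (arity f) → Fin size) → Fin size

module _ (A : FinAlg) where
  open FinAlg A

  data Term (X : Set) : Set where
    var : X → Term X
    app : (f : Fin nops) → (Fin (arity f) → Term X) → Term X

  evalT : ∀ {X} → Term X → (X → Fin size) → Fin size
  evalT (var x)    ρ = ρ x
  evalT (app f ts) ρ = op f (λ i → evalT (ts i) ρ)

  Malcev : Set
  Malcev = Σ (Term (Fin 3)) λ d → (x y : Fin size) →
    (evalT d (lookup (x ∷ y ∷ y ∷ [])) ≡ x) × (evalT d (lookup (y ∷ y ∷ x ∷ [])) ≡ x)

  IsCongruence : (Fin size → Fin size → Bool) → Set
  IsCongruence δ =
    ((x : Fin size) → δ x x ≡ true) ×
    ((x y : Fin size) → δ x y ≡ true → δ y x ≡ true) ×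
    ((x y z : Fin size) → δ x y ≡ true → δ y z ≡ true → δ x z ≡ true) ×
    ((f : Fin nops) (a b : Fin (arity f) → Fin size) →
       ((i : Fin (arity f)) → δ (a i) (b i) ≡ true) → δ (op f a) (op f b) ≡ true)

  Centralizes : (α β : Fin size → Fin size → Set) → (Fin size → Fin size → Bool) → Set
  Centralizes α β δ =
    (m n : ℕ) (t : Term (Fin m ⊎ Fin n)) (a b : Fin m → Fin size) (c d : Fin n → Fin size) →
    ((i : Fin m) → α (a i) (b i)) → ((j : Fin n) → β (c j) (d j)) →
    δ (evalT t [ a , c ]) (evalT t [ a , d ]) ≡ true →
    δ (evalT t [ b , c ]) (evalT t [ b , d ]) ≡ true

  -- commutator [α, β]: the least congruence δ with C(α, β; δ)
  -- (= intersection of all such congruences)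
  Commutator : (α β : Fin size → Fin size → Set) → Fin size → Fin size → Set
  Commutator α β x y = (δ : Fin size → Fin size → Bool) →
    IsCongruence δ → Centralizes α β δ → δ x y ≡ true

  derived : ℕ → Fin size → Fin size → Set
  derived zero    x y = ⊤
  derived (suc k) x y = Commutator (derived k) (derived k) x y

  Solvable : Set
  Solvable = Σ ℕ λ k → (x y : Fin size) → derived k x y → x ≡ y

  -- circuits over A as straight-line programs: each node is an input
  -- variable, a constant, or a basic operation applied to earlier nodes
  data Node (n k : ℕ) : Set where
    nvar   : Fin n → Node n k
    nconst : Fin size → Node n k
    napp   : (f : Fin nops) → (Fin (arity f) → Fin k) → Node n k

  data Circ (n : ℕ) : ℕ → Set where
    []  : Circ n 0
    _▷_ : ∀ {k} → Circ n k → Node n k → Circ n (suc k)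

  nodeVal : ∀ {n k} → (Fin n → Fin size) → (Fin k → Fin size) → Node n k → Fin size
  nodeVal ρ vs (nvar i)    = ρ i
  nodeVal ρ vs (nconst a)  = a
  nodeVal ρ vs (napp f xs) = op f (λ i → vs (xs i))

  -- values of all nodes; the last node is the output
  evalCirc : ∀ {n k} → Circ n k → (Fin n → Fin size) → Vec (Fin size) k
  evalCirc []      ρ = []
  evalCirc (c ▷ g) ρ = nodeVal ρ (lookup (evalCirc c ρ)) g ∷ evalCirc c ρ

  output : ∀ {n s} → Circ n (suc s) → (Fin n → Fin size) → Fin size
  output c ρ = lookup (evalCirc c ρ) fzero

  -- L ∈ nuP_A : recognized by a NuDFA ((t_n), ι, S) of polynomial size
  InNuP : Lang → Set
  InNuP L =
    Σ ((n : ℕ) → Σ ℕ λ s → Circ n (suc s)) λ t →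
    Σ (Bool → Fin size) λ ι →
    Σ (Fin size → Bool) λ S →
      PolyBounded (λ n → suc (Σ.proj₁ (t n))) ×
      ((n : ℕ) (w : Fin n → Bool) → L n w ⇔ (S (output (Σ.proj₂ (t n)) (λ i → ι (w i))) ≡ true))

{-# OPTIONS --safe #-}
module Submission where

-- The algebra lives on ℤ/m₀ × ℤ/m₁ × ⋯ × ℤ/m_L. Each of its three ternary operations acts on coordinate i
-- as (x, y, z) ↦ γ + α xᵢ + κ yᵢ + zᵢ with coefficients depending only on x_{i+1} and y_{i+1}: the Malcev
-- term x − y + z, the multiply-add x_{i+1} yᵢ + zᵢ and the equality test [x_{i+1} = y_{i+1}] + zᵢ.
-- Hence agreeing from coordinate k on is a congruence, and modulo agreement from k + 1 on, coordinate k
-- is affine and therefore central; every step of the derived series gives up one more coordinate.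
-- A BABP_q layer occupies two coordinates: its ABPs are evaluated modulo q by the dynamic programme over
-- path lengths, built from multiply-adds whose edge labels (bits of the layer below, or constants) sit
-- one coordinate higher, and membership in T is the sum over t ∈ T of equality tests, a bit written one
-- coordinate lower. With moduli 2, p₁, p₁ + 1, …, p_h, p_h + 1 a stack of layers of total size s on n
-- inputs becomes a circuit with n + O(s³) nodes.

open import Defs
open import Data.Nat using (ℕ; zero; suc; _+_; _*_; _^_; _≤_; _<_; _≡ᵇ_; z≤n; s≤s; pred; NonZero; >-nonZero; >-nonZero⁻¹)
open import Data.Nat.Properties hiding (_≟_)
open import Data.Nat.DivMod using (_%_; _mod_; m%n<n; m%n%n≡m%n; n%1≡0; m<n⇒m%n≡m; [m+kn]%n≡m%n; %-distribˡ-+; %-distribˡ-*)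
open import Data.Nat.Solver using (module +-*-Solver)
open import Data.Fin using (Fin; toℕ; fromℕ; _≟_) renaming (zero to fzero; suc to fsuc)
open import Data.Fin.Patterns using (0F; 1F; 2F)
open import Data.Fin.Properties using (toℕ-injective; toℕ<n; toℕ-fromℕ<; 1↔⊤; *↔×)
open import Data.Bool using (Bool; true; false; if_then_else_; _∧_)
open import Data.Bool.Properties using (∧-identityʳ; ∧-zeroʳ)
open import Data.List using (List; []; _∷_; length; drop)
open import Data.List.Relation.Unary.All as All using (All; []; _∷_)
open import Data.Nat.ListAction using (sum)
open import Data.Nat.Primality using (Prime; prime⇒nonZero)
open import Data.Vec using (_∷_; []; lookup)
open import Data.Sum using (_⊎_; inj₁; inj₂; [_,_])
open import Data.Sum.Properties using ([,]-∘)
open import Data.Product using (Σ; _×_; _,_; proj₁; proj₂)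
open import Data.Product.Properties using (≡-dec)
open import Data.Product.Function.NonDependent.Propositional using (_×-↔_)
open import Data.Unit using (⊤; tt)
open import Function using (_∘_)
open import Function.Bundles using (_↔_; Inverse; _⇔_; mk⇔)
open import Function.Properties.Equivalence using () renaming (trans to ⇔-trans)
open import Function.Properties.Inverse using (↔-refl; ↔-sym; ↔-trans)
open import Relation.Binary.Definitions using (DecidableEquality)
open import Relation.Nullary using (Dec; yes; no; does)
open import Relation.Nullary.Decidable using (dec-true)
open import Relation.Binary.PropositionalEquality hiding ([_])

import Data.Fin.Properties as Fin
import Data.Unit.Properties as Unit

cong₃ : ∀ {A B C D : Set} (f : A → B → C → D) {x x′ y y′ z z′} →
        x ≡ x′ → y ≡ y′ → z ≡ z′ → f x y z ≡ f x′ y′ z′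
cong₃ f refl refl refl = refl

Tuple : List ℕ → Set
Tuple []       = ⊤
Tuple (m ∷ ms) = Fin (suc m) × Tuple ms

card : List ℕ → ℕ
card []       = 1
card (m ∷ ms) = suc m * card ms

Tuple↔Fin : ∀ ms → Tuple ms ↔ Fin (card ms)
Tuple↔Fin []       = ↔-sym 1↔⊤
Tuple↔Fin (m ∷ ms) = ↔-trans (↔-refl ×-↔ Tuple↔Fin ms) (↔-sym (*↔× {suc m} {card ms}))

module _ (ms : List ℕ) where
  open Inverse (Tuple↔Fin ms)

  encode : Tuple ms → Fin (card ms)
  encode = to

  decode : Fin (card ms) → Tuple ms
  decode = from

  decode-encode : ∀ x → decode (encode x) ≡ x
  decode-encode = strictlyInverseʳ

  encode-decode : ∀ i → encode (decode i) ≡ i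
  encode-decode = strictlyInverseˡ

_≟ₜ_ : ∀ {ms} → DecidableEquality (Tuple ms)
_≟ₜ_ {[]}     = Unit._≟_
_≟ₜ_ {m ∷ ms} = ≡-dec Fin._≟_ _≟ₜ_

-- Coordinate i of a Tuple ms is a residue modulo modulus ms i; past the end it reads 0 (modulus 1).
maxDigit : List ℕ → ℕ → ℕ
maxDigit []       i       = 0
maxDigit (m ∷ ms) zero    = m
maxDigit (m ∷ ms) (suc i) = maxDigit ms i

modulus : List ℕ → ℕ → ℕ
modulus ms i = suc (maxDigit ms i)

get : ∀ {ms} → ℕ → Tuple ms → ℕ
get {[]}     i       x       = 0
get {m ∷ ms} zero    (a , x) = toℕ a
get {m ∷ ms} (suc i) (a , x) = get i x

constant : ∀ ms → ℕ → Tuple ms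
constant []       v = tt
constant (m ∷ ms) v = v mod suc m , constant ms v

toℕ-mod : ∀ m v → toℕ (v mod suc m) ≡ v % suc m
toℕ-mod m v = toℕ-fromℕ< (m%n<n v (suc m))

get-constant : ∀ ms i v → get i (constant ms v) ≡ v % modulus ms i
get-constant []       i       v = sym (n%1≡0 v)
get-constant (m ∷ ms) zero    v = toℕ-mod m v
get-constant (m ∷ ms) (suc i) v = get-constant ms i v

pattern dOp      = 0F
pattern mulAddOp = 1F
pattern eqAddOp  = 2F

-- The coefficients (γ , α , κ) at a coordinate of modulus suc m, where x′ and y′ are the next coordinates of x and y.
Coefficients : Set
Coefficients = ℕ × ℕ × ℕ

coefficients : Fin 3 → (m x′ y′ : ℕ) → Coefficients
coefficients dOp      m x′ y′ = 0 , 1 , m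
coefficients mulAddOp m x′ y′ = 0 , 0 , x′
coefficients eqAddOp  m x′ y′ = bit (x′ ≡ᵇ y′) , 0 , 0

affine : Coefficients → ℕ → ℕ → ℕ → ℕ
affine (γ , α , κ) x y z = γ + (α * x + (κ * y + z))

apply : ∀ {ms} → Fin 3 → Tuple ms → Tuple ms → Tuple ms → Tuple ms
apply {[]}     f _       _       _       = tt
apply {m ∷ ms} f (a , x) (b , y) (c , z) =
  affine (coefficients f m (get 0 x) (get 0 y)) (toℕ a) (toℕ b) (toℕ c) mod suc m , apply f x y z

get-apply : ∀ {ms} f i (x y z : Tuple ms) → get i (apply f x y z) ≡
  affine (coefficients f (maxDigit ms i) (get (suc i) x) (get (suc i) y)) (get i x) (get i y) (get i z) % modulus ms i
get-apply {[]}     f i       x y z = sym (n%1≡0 (affine (coefficients f 0 0 0) 0 0 0))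
get-apply {m ∷ ms} f zero    (a , x) (b , y) (c , z) =
  toℕ-mod m (affine (coefficients f m (get 0 x) (get 0 y)) (toℕ a) (toℕ b) (toℕ c))
get-apply {m ∷ ms} f (suc i) x y z = get-apply f i (proj₂ x) (proj₂ y) (proj₂ z)

algebra : List ℕ → FinAlg
algebra ms = record
  { size  = card ms
  ; nops  = 3
  ; arity = λ _ → 3
  ; op    = λ f xs → encode ms (apply f (decode ms (xs 0F)) (decode ms (xs 1F)) (decode ms (xs 2F)))
  }

decode-op : ∀ ms f (xs : Fin 3 → Fin (card ms)) →
  decode ms (FinAlg.op (algebra ms) f xs) ≡ apply f (decode ms (xs 0F)) (decode ms (xs 1F)) (decode ms (xs 2F))
decode-op ms f xs = decode-encode ms _

-- At each coordinate d(x, y, z) = x + m y + z ≡ x − y + z (mod suc m).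
module _ {m : ℕ} where
  open +-*-Solver

  mod-cancel : ∀ (a : Fin (suc m)) k → (toℕ a + k * suc m) mod suc m ≡ a
  mod-cancel a k = toℕ-injective (begin
    toℕ ((toℕ a + k * suc m) mod suc m) ≡⟨ toℕ-mod m (toℕ a + k * suc m) ⟩
    (toℕ a + k * suc m) % suc m         ≡⟨ [m+kn]%n≡m%n (toℕ a) k (suc m) ⟩
    toℕ a % suc m                       ≡⟨ m<n⇒m%n≡m (toℕ<n a) ⟩
    toℕ a                               ∎)
    where open ≡-Reasoning

  dOp-xyy : ∀ (a b : Fin (suc m)) → affine (0 , 1 , m) (toℕ a) (toℕ b) (toℕ b) mod suc m ≡ a
  dOp-xyy a b = trans (cong (λ v → v mod suc m)
    (solve 3 (λ x y m → con 1 :* x :+ (m :* y :+ y) := x :+ y :* (con 1 :+ m)) refl (toℕ a) (toℕ b) m)) (mod-cancel a (toℕ b))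

  dOp-yyx : ∀ (a b : Fin (suc m)) → affine (0 , 1 , m) (toℕ b) (toℕ b) (toℕ a) mod suc m ≡ a
  dOp-yyx a b = trans (cong (λ v → v mod suc m)
    (solve 3 (λ x y m → con 1 :* y :+ (m :* y :+ x) := x :+ y :* (con 1 :+ m)) refl (toℕ a) (toℕ b) m)) (mod-cancel a (toℕ b))

apply-dOp-xyy : ∀ {ms} (x y : Tuple ms) → apply dOp x y y ≡ x
apply-dOp-xyy {[]}     x       y       = refl
apply-dOp-xyy {m ∷ ms} (a , x) (b , y) = cong₂ _,_ (dOp-xyy a b) (apply-dOp-xyy x y)

apply-dOp-yyx : ∀ {ms} (x y : Tuple ms) → apply dOp y y x ≡ x
apply-dOp-yyx {[]}     x       y       = refl
apply-dOp-yyx {m ∷ ms} (a , x) (b , y) = cong₂ _,_ (dOp-yyx a b) (apply-dOp-yyx x y)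

algebra-malcev : ∀ ms → Malcev (algebra ms)
algebra-malcev ms = app dOp var , λ x y →
  trans (cong (encode ms) (apply-dOp-xyy (decode ms x) (decode ms y))) (encode-decode ms x) ,
  trans (cong (encode ms) (apply-dOp-yyx (decode ms x) (decode ms y))) (encode-decode ms x)

module Modular (m : ℕ) where

  infix 4 _≈_

  _≈_ : ℕ → ℕ → Set
  x ≈ y = x % suc m ≡ y % suc m

  %-≈ : ∀ x → x % suc m ≈ x
  %-≈ x = m%n%n≡m%n x (suc m)

  +-≈ : ∀ x x′ y y′ → x ≈ x′ → y ≈ y′ → x + y ≈ x′ + y′
  +-≈ x x′ y y′ p q = begin
    (x + y) % suc m                       ≡⟨ %-distribˡ-+ x y (suc m) ⟩
    (x % suc m + y % suc m) % suc m       ≡⟨ cong₂ (λ u v → (u + v) % suc m) p q ⟩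
    (x′ % suc m + y′ % suc m) % suc m     ≡⟨ %-distribˡ-+ x′ y′ (suc m) ⟨
    (x′ + y′) % suc m                     ∎
    where open ≡-Reasoning

  *-≈ : ∀ k y y′ → y ≈ y′ → k * y ≈ k * y′
  *-≈ k y y′ p = begin
    (k * y) % suc m                       ≡⟨ %-distribˡ-* k y (suc m) ⟩
    (k % suc m * (y % suc m)) % suc m     ≡⟨ cong (λ u → (k % suc m * u) % suc m) p ⟩
    (k % suc m * (y′ % suc m)) % suc m    ≡⟨ %-distribˡ-* k y′ (suc m) ⟨
    (k * y′) % suc m                      ∎
    where open ≡-Reasoning

  affine-≈ : ∀ κ x x′ y y′ z z′ → x ≈ x′ → y ≈ y′ → z ≈ z′ → affine κ x y z ≈ affine κ x′ y′ z′
  affine-≈ (γ , α , κ) x x′ y y′ z z′ p q r =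
    +-≈ γ γ _ _ refl (+-≈ (α * x) (α * x′) _ _ (*-≈ α x x′ p) (+-≈ (κ * y) (κ * y′) z z′ (*-≈ κ y y′ q) r))

  +-cancelʳ-≈ : ∀ x y z → x + z ≈ y + z → x ≈ y
  +-cancelʳ-≈ x y z p = begin
    x % suc m                    ≡⟨ [m+kn]%n≡m%n x z (suc m) ⟨
    (x + z * suc m) % suc m      ≡⟨ cong (_% suc m) (shift x) ⟩
    (x + z + z * m) % suc m      ≡⟨ +-≈ (x + z) (y + z) (z * m) (z * m) p refl ⟩
    (y + z + z * m) % suc m      ≡⟨ cong (_% suc m) (shift y) ⟨
    (y + z * suc m) % suc m      ≡⟨ [m+kn]%n≡m%n y z (suc m) ⟩
    y % suc m                    ∎
    where
    open ≡-Reasoning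
    open +-*-Solver
    shift : ∀ u → u + z * suc m ≡ u + z + z * m
    shift u = solve 3 (λ u z m → u :+ z :* (con 1 :+ m) := u :+ z :+ z :* m) refl u z m

  ≈-residue : ∀ {a b : Fin (suc m)} → toℕ a ≈ toℕ b → a ≡ b
  ≈-residue {a} {b} p = toℕ-injective (trans (sym (m<n⇒m%n≡m (toℕ<n a))) (trans p (m<n⇒m%n≡m (toℕ<n b))))

  -- x₁ − x₂ − x₃ + x₄ ≡ 0 (mod suc m), written without subtraction.
  Parallelogram : ℕ → ℕ → ℕ → ℕ → Set
  Parallelogram x₁ x₂ x₃ x₄ = x₁ + x₄ ≈ x₂ + x₃

  affine-+ : ∀ γ α κ x y z x′ y′ z′ →
    affine (γ , α , κ) x y z + affine (γ , α , κ) x′ y′ z′ ≡ affine (γ + γ , α , κ) (x + x′) (y + y′) (z + z′)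
  affine-+ = solve 9 (λ γ α κ x y z x′ y′ z′ →
      (γ :+ (α :* x :+ (κ :* y :+ z))) :+ (γ :+ (α :* x′ :+ (κ :* y′ :+ z′)))
      := (γ :+ γ) :+ (α :* (x :+ x′) :+ (κ :* (y :+ y′) :+ (z :+ z′)))) refl
    where open +-*-Solver

  affine-parallelogram : ∀ κ {x₁ x₂ x₃ x₄ y₁ y₂ y₃ y₄ z₁ z₂ z₃ z₄} →
    Parallelogram x₁ x₂ x₃ x₄ → Parallelogram y₁ y₂ y₃ y₄ → Parallelogram z₁ z₂ z₃ z₄ →
    Parallelogram (affine κ x₁ y₁ z₁ % suc m) (affine κ x₂ y₂ z₂ % suc m)
                  (affine κ x₃ y₃ z₃ % suc m) (affine κ x₄ y₄ z₄ % suc m)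
  affine-parallelogram (γ , α , κ) {x₁} {x₂} {x₃} {x₄} {y₁} {y₂} {y₃} {y₄} {z₁} {z₂} {z₃} {z₄} px py pz = begin
    (f x₁ y₁ z₁ % suc m + f x₄ y₄ z₄ % suc m) % suc m
      ≡⟨ %-distribˡ-+ (f x₁ y₁ z₁) (f x₄ y₄ z₄) (suc m) ⟨
    (f x₁ y₁ z₁ + f x₄ y₄ z₄) % suc m
      ≡⟨ cong (_% suc m) (affine-+ γ α κ x₁ y₁ z₁ x₄ y₄ z₄) ⟩
    (f₂ (x₁ + x₄) (y₁ + y₄) (z₁ + z₄)) % suc m
      ≡⟨ affine-≈ (γ + γ , α , κ) (x₁ + x₄) (x₂ + x₃) (y₁ + y₄) (y₂ + y₃) (z₁ + z₄) (z₂ + z₃) px py pz ⟩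
    (f₂ (x₂ + x₃) (y₂ + y₃) (z₂ + z₃)) % suc m
      ≡⟨ cong (_% suc m) (affine-+ γ α κ x₂ y₂ z₂ x₃ y₃ z₃) ⟨
    (f x₂ y₂ z₂ + f x₃ y₃ z₃) % suc m
      ≡⟨ %-distribˡ-+ (f x₂ y₂ z₂) (f x₃ y₃ z₃) (suc m) ⟩
    (f x₂ y₂ z₂ % suc m + f x₃ y₃ z₃ % suc m) % suc m  ∎
    where
    open ≡-Reasoning
    f f₂ : ℕ → ℕ → ℕ → ℕ
    f  = affine (γ , α , κ)
    f₂ = affine (γ + γ , α , κ)

module _ {m : ℕ} {ms : List ℕ} where
  open Modular m

  head : Tuple (m ∷ ms) → ℕ
  head (a , x) = toℕ a

  record Square (x₁ x₂ x₃ x₄ : Tuple (m ∷ ms)) : Set where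
    field
      tail₂ : proj₂ x₂ ≡ proj₂ x₁
      tail₃ : proj₂ x₃ ≡ proj₂ x₁
      tail₄ : proj₂ x₄ ≡ proj₂ x₁
      heads : Parallelogram (head x₁) (head x₂) (head x₃) (head x₄)

  square-apply : ∀ f {x₁ x₂ x₃ x₄ y₁ y₂ y₃ y₄ z₁ z₂ z₃ z₄} →
    Square x₁ x₂ x₃ x₄ → Square y₁ y₂ y₃ y₄ → Square z₁ z₂ z₃ z₄ →
    Square (apply f x₁ y₁ z₁) (apply f x₂ y₂ z₂) (apply f x₃ y₃ z₃) (apply f x₄ y₄ z₄)
  square-apply f {x₁} {x₂} {x₃} {x₄} {y₁} {y₂} {y₃} {y₄} {z₁} {z₂} {z₃} {z₄} X Y Z = record
    { tail₂ = cong₃ (apply f) (tail₂ X) (tail₂ Y) (tail₂ Z)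
    ; tail₃ = cong₃ (apply f) (tail₃ X) (tail₃ Y) (tail₃ Z)
    ; tail₄ = cong₃ (apply f) (tail₄ X) (tail₄ Y) (tail₄ Z)
    ; heads = begin
        (head r₁ + head r₄) % suc m
          ≡⟨ cong₂ (λ u v → (u + v) % suc m)
               (head-apply x₁ y₁ z₁ refl refl) (head-apply x₄ y₄ z₄ (tail₄ X) (tail₄ Y)) ⟩
        (f₁ x₁ y₁ z₁ % suc m + f₁ x₄ y₄ z₄ % suc m) % suc m
          ≡⟨ affine-parallelogram κ (heads X) (heads Y) (heads Z) ⟩
        (f₁ x₂ y₂ z₂ % suc m + f₁ x₃ y₃ z₃ % suc m) % suc m
          ≡⟨ cong₂ (λ u v → (u + v) % suc m)
               (head-apply x₂ y₂ z₂ (tail₂ X) (tail₂ Y)) (head-apply x₃ y₃ z₃ (tail₃ X) (tail₃ Y)) ⟨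
        (head r₂ + head r₃) % suc m                       ∎
    }
    where
    open Square
    open ≡-Reasoning
    κ : Coefficients
    κ = coefficients f m (get 0 (proj₂ x₁)) (get 0 (proj₂ y₁))
    f₁ : Tuple (m ∷ ms) → Tuple (m ∷ ms) → Tuple (m ∷ ms) → ℕ
    f₁ x y z = affine κ (head x) (head y) (head z)
    r₁ r₂ r₃ r₄ : Tuple (m ∷ ms)
    r₁ = apply f x₁ y₁ z₁
    r₂ = apply f x₂ y₂ z₂
    r₃ = apply f x₃ y₃ z₃
    r₄ = apply f x₄ y₄ z₄
    head-apply : ∀ x y z → proj₂ x ≡ proj₂ x₁ → proj₂ y ≡ proj₂ y₁ → head (apply f x y z) ≡ f₁ x y z % suc m
    head-apply x y z refl refl = toℕ-mod m (f₁ x y z)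

dropₜ : ∀ {ms} k → Tuple ms → Tuple (drop k ms)
dropₜ zero    x = x
dropₜ {[]}     (suc k) x       = tt
dropₜ {m ∷ ms} (suc k) (a , x) = dropₜ k x

AgreeFrom : ∀ {ms} → ℕ → Tuple ms → Tuple ms → Set
AgreeFrom k x y = dropₜ k x ≡ dropₜ k y

agreeFrom? : ∀ {ms} k (x y : Tuple ms) → Dec (AgreeFrom k x y)
agreeFrom? k x y = dropₜ k x ≟ₜ dropₜ k y

agreeFrom-length : ∀ {ms} k → length ms ≤ k → (x y : Tuple ms) → AgreeFrom k x y
agreeFrom-length {[]}     zero    _         x y = refl
agreeFrom-length {[]}     (suc k) _         x y = refl
agreeFrom-length {m ∷ ms} (suc k) (s≤s len) x y = agreeFrom-length k len (proj₂ x) (proj₂ y)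

dropₜ-apply : ∀ {ms} k f (x y z : Tuple ms) → dropₜ k (apply f x y z) ≡ apply f (dropₜ k x) (dropₜ k y) (dropₜ k z)
dropₜ-apply zero    f x y z = refl
dropₜ-apply {[]}     (suc k) f x y z = refl
dropₜ-apply {m ∷ ms} (suc k) f x y z = dropₜ-apply k f (proj₂ x) (proj₂ y) (proj₂ z)

agreeFrom-apply : ∀ {ms} k f {x x′ y y′ z z′ : Tuple ms} →
  AgreeFrom k x x′ → AgreeFrom k y y′ → AgreeFrom k z z′ → AgreeFrom k (apply f x y z) (apply f x′ y′ z′)
agreeFrom-apply k f {x} {x′} {y} {y′} {z} {z′} p q r =
  trans (dropₜ-apply k f x y z) (trans (cong₃ (apply f) p q r) (sym (dropₜ-apply k f x′ y′ z′)))

module _ (ms₀ : List ℕ) where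
  private
    A : FinAlg
    A = algebra ms₀

  -- Terms of the algebra can be evaluated in Tuple ms for every ms, not only ms₀.
  ⟦_⟧ : ∀ {ms X} → Term A X → (X → Tuple ms) → Tuple ms
  ⟦ var x ⟧    ρ = ρ x
  ⟦ app f ts ⟧ ρ = apply f (⟦ ts 0F ⟧ ρ) (⟦ ts 1F ⟧ ρ) (⟦ ts 2F ⟧ ρ)

  ⟦⟧-cong : ∀ {ms X} (t : Term A X) {ρ σ : X → Tuple ms} → (∀ x → ρ x ≡ σ x) → ⟦ t ⟧ ρ ≡ ⟦ t ⟧ σ
  ⟦⟧-cong (var x)    e = e x
  ⟦⟧-cong (app f ts) e = cong₃ (apply f) (⟦⟧-cong (ts 0F) e) (⟦⟧-cong (ts 1F) e) (⟦⟧-cong (ts 2F) e)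

  decode-evalT : ∀ {X} (t : Term A X) (ρ : X → Fin (card ms₀)) → decode ms₀ (evalT A t ρ) ≡ ⟦ t ⟧ (decode ms₀ ∘ ρ)
  decode-evalT (var x)    ρ = refl
  decode-evalT (app f ts) ρ = trans (decode-op ms₀ f (λ i → evalT A (ts i) ρ))
    (cong₃ (apply f) (decode-evalT (ts 0F) ρ) (decode-evalT (ts 1F) ρ) (decode-evalT (ts 2F) ρ))

  tail-⟦⟧ : ∀ {m ms X} (t : Term A X) (ρ : X → Tuple (m ∷ ms)) → proj₂ (⟦ t ⟧ ρ) ≡ ⟦ t ⟧ (proj₂ ∘ ρ)
  tail-⟦⟧ (var x)    ρ = refl
  tail-⟦⟧ (app f ts) ρ = cong₃ (apply f) (tail-⟦⟧ (ts 0F) ρ) (tail-⟦⟧ (ts 1F) ρ) (tail-⟦⟧ (ts 2F) ρ)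

  square-⟦⟧ : ∀ {m ms X} (t : Term A X) {ρ₁ ρ₂ ρ₃ ρ₄ : X → Tuple (m ∷ ms)} →
    (∀ x → Square (ρ₁ x) (ρ₂ x) (ρ₃ x) (ρ₄ x)) → Square (⟦ t ⟧ ρ₁) (⟦ t ⟧ ρ₂) (⟦ t ⟧ ρ₃) (⟦ t ⟧ ρ₄)
  square-⟦⟧ (var x)    sq = sq x
  square-⟦⟧ (app f ts) sq = square-apply f (square-⟦⟧ (ts 0F) sq) (square-⟦⟧ (ts 1F) sq) (square-⟦⟧ (ts 2F) sq)

  -- The term condition C(α, α; AgreeFrom k) for α ⊆ AgreeFrom (suc k), read on tuples.
  TermCondition : ∀ {ms} → ℕ → Set
  TermCondition {ms} k = ∀ {M N} (t : Term A (Fin M ⊎ Fin N)) (a b : Fin M → Tuple ms) (c d : Fin N → Tuple ms) →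
    (∀ i → AgreeFrom (suc k) (a i) (b i)) → (∀ j → AgreeFrom (suc k) (c j) (d j)) →
    AgreeFrom k (⟦ t ⟧ [ a , c ]) (⟦ t ⟧ [ a , d ]) → AgreeFrom k (⟦ t ⟧ [ b , c ]) (⟦ t ⟧ [ b , d ])

  -- The lowest coordinate is central modulo the others: compare the four evaluations as a Square and cancel.
  head-termCondition : ∀ {m ms} → TermCondition {m ∷ ms} 0
  head-termCondition {m} t a b c d ab cd e = cong₂ _,_ (≈-residue heads) (sym (Square.tail₂ sq))
    where
    open Modular m
    corner : ∀ x → Square ([ b , c ] x) ([ b , d ] x) ([ a , c ] x) ([ a , d ] x)
    corner (inj₁ i) = record { tail₂ = refl ; tail₃ = ab i ; tail₄ = ab i ; heads = refl }
    corner (inj₂ j) = record { tail₂ = sym (cd j) ; tail₃ = refl ; tail₄ = sym (cd j)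
                             ; heads = cong (_% suc m) (+-comm (head (c j)) (head (d j))) }
    sq : Square (⟦ t ⟧ [ b , c ]) (⟦ t ⟧ [ b , d ]) (⟦ t ⟧ [ a , c ]) (⟦ t ⟧ [ a , d ])
    sq = square-⟦⟧ t corner
    heads : head (⟦ t ⟧ [ b , c ]) ≈ head (⟦ t ⟧ [ b , d ])
    heads = +-cancelʳ-≈ (head (⟦ t ⟧ [ b , c ])) (head (⟦ t ⟧ [ b , d ])) (head (⟦ t ⟧ [ a , c ]))
      (subst (λ z → head (⟦ t ⟧ [ b , c ]) + head z ≈ head (⟦ t ⟧ [ b , d ]) + head (⟦ t ⟧ [ a , c ]))
        (sym e) (Square.heads sq))

  termCondition : ∀ {ms} k → TermCondition {ms} k
  termCondition {[]}     k       t a b c d _  _  _ = agreeFrom-length k z≤n _ _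
  termCondition {m ∷ ms} zero    = head-termCondition
  termCondition {m ∷ ms} (suc k) t a b c d ab cd e =
    subst₂ (AgreeFrom k) (sym (tail b c)) (sym (tail b d))
      (termCondition k t (proj₂ ∘ a) (proj₂ ∘ b) (proj₂ ∘ c) (proj₂ ∘ d) ab cd
        (subst₂ (AgreeFrom k) (tail a c) (tail a d) e))
    where
    tail : ∀ a′ c′ → proj₂ (⟦ t ⟧ [ a′ , c′ ]) ≡ ⟦ t ⟧ [ proj₂ ∘ a′ , proj₂ ∘ c′ ]
    tail a′ c′ = trans (tail-⟦⟧ t [ a′ , c′ ]) (⟦⟧-cong t ([,]-∘ proj₂))

  agreeFrom-congruence : ℕ → Fin (card ms₀) → Fin (card ms₀) → Bool
  agreeFrom-congruence k x y = does (agreeFrom? k (decode ms₀ x) (decode ms₀ y))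

  agreeFrom-congruence⁺ : ∀ k x y → AgreeFrom k (decode ms₀ x) (decode ms₀ y) → agreeFrom-congruence k x y ≡ true
  agreeFrom-congruence⁺ k x y = dec-true (agreeFrom? k (decode ms₀ x) (decode ms₀ y))

  agreeFrom-congruence⁻ : ∀ k x y → agreeFrom-congruence k x y ≡ true → AgreeFrom k (decode ms₀ x) (decode ms₀ y)
  agreeFrom-congruence⁻ k x y with agreeFrom? k (decode ms₀ x) (decode ms₀ y)
  ... | yes p = λ _ → p
  ... | no _  = λ ()

  isCongruence-agreeFrom : ∀ k → IsCongruence A (agreeFrom-congruence k)
  isCongruence-agreeFrom k =
    (λ x → ⁺ x x refl) ,
    (λ x y p → ⁺ y x (sym (⁻ x y p))) ,
    (λ x y z p q → ⁺ x z (trans (⁻ x y p) (⁻ y z q))) ,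
    (λ f a b p → ⁺ (op f a) (op f b) (subst₂ (AgreeFrom k) (sym (decode-op ms₀ f a)) (sym (decode-op ms₀ f b))
      (agreeFrom-apply k f (⁻ (a 0F) (b 0F) (p 0F)) (⁻ (a 1F) (b 1F) (p 1F)) (⁻ (a 2F) (b 2F) (p 2F)))))
    where
    open FinAlg A using (op)
    ⁺ : ∀ x y → AgreeFrom k (decode ms₀ x) (decode ms₀ y) → agreeFrom-congruence k x y ≡ true
    ⁺ = agreeFrom-congruence⁺ k
    ⁻ : ∀ x y → agreeFrom-congruence k x y ≡ true → AgreeFrom k (decode ms₀ x) (decode ms₀ y)
    ⁻ = agreeFrom-congruence⁻ k

  centralizes-agreeFrom : ∀ k (α : Fin (card ms₀) → Fin (card ms₀) → Set) →
    (∀ x y → α x y → AgreeFrom (suc k) (decode ms₀ x) (decode ms₀ y)) → Centralizes A α α (agreeFrom-congruence k)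
  centralizes-agreeFrom k α α⊆ M N t a b c d αab αcd p = agreeFrom-congruence⁺ k _ _
    (subst₂ (AgreeFrom k) (sym (decode-env b c)) (sym (decode-env b d))
      (termCondition k t (decode ms₀ ∘ a) (decode ms₀ ∘ b) (decode ms₀ ∘ c) (decode ms₀ ∘ d)
        (λ i → α⊆ _ _ (αab i)) (λ j → α⊆ _ _ (αcd j))
        (subst₂ (AgreeFrom k) (decode-env a c) (decode-env a d) (agreeFrom-congruence⁻ k _ _ p))))
    where
    decode-env : ∀ a′ c′ → decode ms₀ (evalT A t [ a′ , c′ ]) ≡ ⟦ t ⟧ [ decode ms₀ ∘ a′ , decode ms₀ ∘ c′ ]
    decode-env a′ c′ = trans (decode-evalT t [ a′ , c′ ]) (⟦⟧-cong t ([,]-∘ (decode ms₀)))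

  derived⇒agreeFrom : ∀ i k → length ms₀ ≤ k + i → ∀ x y → derived A i x y → AgreeFrom k (decode ms₀ x) (decode ms₀ y)
  derived⇒agreeFrom zero    k len x y _ = agreeFrom-length k (subst (length ms₀ ≤_) (+-identityʳ k) len) _ _
  derived⇒agreeFrom (suc i) k len x y D = agreeFrom-congruence⁻ k x y
    (D (agreeFrom-congruence k) (isCongruence-agreeFrom k)
       (centralizes-agreeFrom k (derived A i) (derived⇒agreeFrom i (suc k) (subst (length ms₀ ≤_) (+-suc k i) len))))

  algebra-solvable : Solvable A
  algebra-solvable = length ms₀ , λ x y D →
    trans (sym (encode-decode ms₀ x))
      (trans (cong (encode ms₀) (derived⇒agreeFrom (length ms₀) 0 ≤-refl x y D)) (encode-decode ms₀ y))

-- Node counts of the constructions below, defined by the same recursions so that their bounds hold definitionally.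
chainCost : ℕ → ℕ
chainCost zero    = 1
chainCost (suc l) = chainCost l + 2

module _ {q a : ℕ} (abp : ABP q a) where
  open ABP abp using (V; edges)

  rowCost : ℕ
  rowCost = ΣFin (suc V) (λ _ → chainCost (length edges))

  walkCost : ℕ → ℕ
  walkCost zero    = ΣFin (suc V) (λ _ → 1)
  walkCost (suc j) = walkCost j + (rowCost + 1)

  abpCost : ℕ
  abpCost = 1 + walkCost V

gateCost : ∀ {p m} → Gate p m → ℕ
gateCost {p} g = abpCost (Gate.abp g) + chainCost p

stackCost : ∀ {n qs m} → Stack n qs m → ℕ
stackCost {n} inputs          = ΣFin n (λ _ → 1)
stackCost     (layer p m g s) = stackCost s + ΣFin m (λ u → gateCost (g u))

-- A layer with modulus q whose gates output at coordinate o keeps its output bits at coordinate o,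
-- evaluates its ABPs at coordinate suc o (which must have modulus exactly q) and reads the bits of the
-- layer below, as well as the constants of GF(q), at coordinate suc (suc o).
Hosts : List ℕ → ℕ → List ℕ → Set
Hosts ms o []       = 2 ≤ modulus ms o
Hosts ms o (q ∷ qs) = 2 ≤ modulus ms o × modulus ms (suc o) ≡ q × q ≤ modulus ms (suc (suc o)) × Hosts ms (suc (suc o)) qs

hosts⇒2≤ : ∀ ms o qs → Hosts ms o qs → 2 ≤ modulus ms o
hosts⇒2≤ ms o []       2≤          = 2≤
hosts⇒2≤ ms o (q ∷ qs) (2≤ , _)    = 2≤

bit<2 : ∀ b → bit b < 2
bit<2 false = s≤s z≤n
bit<2 true  = s≤s (s≤s z≤n)

indicatorSum : ∀ {q} (T : Fin q → Bool) (y : Fin q) → ΣFin q (λ t → bit (T t ∧ (toℕ y ≡ᵇ toℕ t))) ≡ bit (T y)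
indicatorSum {suc q} T fzero    = trans
  (cong₂ _+_ (cong bit (∧-identityʳ (T 0F))) (ΣFin-zero q λ t → cong bit (∧-zeroʳ (T (fsuc t)))))
  (+-identityʳ (bit (T 0F)))
  where
  ΣFin-zero : ∀ q {f : Fin q → ℕ} → (∀ t → f t ≡ 0) → ΣFin q f ≡ 0
  ΣFin-zero zero    f≡0 = refl
  ΣFin-zero (suc q) f≡0 = cong₂ _+_ (f≡0 0F) (ΣFin-zero q (f≡0 ∘ fsuc))
indicatorSum {suc q} T (fsuc y) = cong₂ _+_ (cong bit (∧-zeroʳ (T 0F))) (indicatorSum (T ∘ fsuc) y)

-- Input bits are fed in as constant tuples, so every coordinate can read them.
encodeBit : ∀ ms → Bool → Fin (card ms)
encodeBit ms b = encode ms (constant ms (bit b))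

module Simulation (ms : List ℕ) (n : ℕ) where
  private
    A : FinAlg
    A = algebra ms

  Circuit : ℕ → Set
  Circuit = Circ A n

  Input : Set
  Input = Fin n → Bool

  value : ∀ {k} → Circuit k → Input → Fin k → Tuple ms
  value c w r = decode ms (lookup (evalCirc A c (encodeBit ms ∘ w)) r)

  -- Multipliers and compared values are read from the coordinate above, so they must be held exactly;
  -- accumulators only modulo their own coordinate.
  record Exact (i : ℕ) (F : Input → ℕ) {k : ℕ} (c : Circuit k) : Set where
    constructor exact
    field
      node   : Fin k
      holds  : ∀ w → get i (value c w node) ≡ F w

  record Residue (i : ℕ) (F : Input → ℕ) {k : ℕ} (c : Circuit k) : Set where
    constructor residue
    field
      node   : Fin k
      holds  : ∀ w → get i (value c w node) ≡ F w % modulus ms i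

  residue⇒exact : ∀ {i F k} {c : Circuit k} → Residue i F c → Exact i (λ w → F w % modulus ms i) c
  residue⇒exact (residue r p) = exact r p

  exact-≗ : ∀ {i F G k} {c : Circuit k} → (∀ w → F w ≡ G w) → Exact i F c → Exact i G c
  exact-≗ F≗G (exact r p) = exact r (λ w → trans (p w) (F≗G w))

  residue-≗ : ∀ {i F G k} {c : Circuit k} → (∀ w → F w ≡ G w) → Residue i F c → Residue i G c
  residue-≗ {i} F≗G (residue r p) = residue r (λ w → trans (p w) (cong (_% modulus ms i) (F≗G w)))

  record _⊑_ {k k′ : ℕ} (c : Circuit k) (c′ : Circuit k′) : Set where
    field
      embed       : Fin k → Fin k′
      value-embed : ∀ w r → value c′ w (embed r) ≡ value c w r
  open _⊑_

  ⊑-refl : ∀ {k} {c : Circuit k} → c ⊑ c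
  ⊑-refl = record { embed = λ r → r ; value-embed = λ w r → refl }

  ⊑-trans : ∀ {k k′ k″} {c : Circuit k} {c′ : Circuit k′} {c″ : Circuit k″} → c ⊑ c′ → c′ ⊑ c″ → c ⊑ c″
  ⊑-trans e e′ = record
    { embed       = embed e′ ∘ embed e
    ; value-embed = λ w r → trans (value-embed e′ w (embed e r)) (value-embed e w r) }

  ⊑-▷ : ∀ {k} {c : Circuit k} (g : Node A n k) → c ⊑ (c ▷ g)
  ⊑-▷ g = record { embed = fsuc ; value-embed = λ w r → refl }

  Stable : (∀ {k} → Circuit k → Set) → Set
  Stable P = ∀ {k k′} {c : Circuit k} {c′ : Circuit k′} → c ⊑ c′ → P c → P c′

  exact-⊑ : ∀ {i F} → Stable (Exact i F)
  exact-⊑ e (exact r p) = exact (embed e r) (λ w → trans (cong (get _) (value-embed e w r)) (p w))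

  residue-⊑ : ∀ {i F} → Stable (Residue i F)
  residue-⊑ e (residue r p) = residue (embed e r) (λ w → trans (cong (get _) (value-embed e w r)) (p w))

  record Build {k : ℕ} (c : Circuit k) (B : ℕ) (P : ∀ {k′} → Circuit k′ → Set) : Set where
    constructor built
    field
      {size}  : ℕ
      circuit : Circuit size
      extends : c ⊑ circuit
      bounded : size ≤ k + B
      result  : P circuit

  module _ {k : ℕ} {c : Circuit k} {P : ∀ {k′} → Circuit k′ → Set} where

    return : P c → Build c 0 P
    return p = built c ⊑-refl (≤-reflexive (sym (+-identityʳ k))) p

    weaken : ∀ {B B′} → B ≤ B′ → Build c B P → Build c B′ P
    weaken B≤B′ (built c′ e b p) = built c′ e (≤-trans b (+-monoʳ-≤ k B≤B′)) p

    mapWith : ∀ {B} {Q : ∀ {k′} → Circuit k′ → Set} →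
      (∀ {k′} {c′ : Circuit k′} → c ⊑ c′ → P c′ → Q c′) → Build c B P → Build c B Q
    mapWith f (built c′ e b p) = built c′ e b (f e p)

    infixr 4 _<$>_
    _<$>_ : ∀ {B} {Q : ∀ {k′} → Circuit k′ → Set} →
      (∀ {k′} {c′ : Circuit k′} → P c′ → Q c′) → Build c B P → Build c B Q
    f <$> b = mapWith (λ _ → f) b

    infixl 1 _>>=_
    _>>=_ : ∀ {B B′} {Q : ∀ {k′} → Circuit k′ → Set} → Build c B P →
      (∀ {k′} {c′ : Circuit k′} → c ⊑ c′ → P c′ → Build c′ B′ Q) → Build c (B + B′) Q
    _>>=_ {B} {B′} (built c′ e b p) f with f e p
    ... | built c″ e′ b′ q =
      built c″ (⊑-trans e e′) (≤-trans b′ (≤-trans (+-monoˡ-≤ B′ b) (≤-reflexive (+-assoc k B B′)))) q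

  buildAll : ∀ {k} {c : Circuit k} N (B : Fin N → ℕ) (P : Fin N → ∀ {k′} → Circuit k′ → Set) →
    (∀ u → Stable (P u)) → (∀ {k′} {c′ : Circuit k′} → c ⊑ c′ → ∀ u → Build c′ (B u) (P u)) →
    Build c (ΣFin N B) (λ c′ → ∀ u → P u c′)
  buildAll zero    B P stable build = return (λ ())
  buildAll (suc N) B P stable build =
    build ⊑-refl 0F >>= λ e₀ p₀ →
    mapWith (λ e ps → λ { fzero → stable 0F e p₀ ; (fsuc u) → ps u })
      (buildAll N (B ∘ fsuc) (P ∘ fsuc) (stable ∘ fsuc) (λ e u → build (⊑-trans e₀ e) (fsuc u)))

  addNode : ∀ {k} {c : Circuit k} {P : ∀ {k′} → Circuit k′ → Set} (g : Node A n k) → P (c ▷ g) → Build c 1 P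
  addNode {k} {c} g p = built (c ▷ g) (⊑-▷ g) (≤-reflexive (+-comm 1 k)) p

  constantNode : ∀ {k} (c : Circuit k) i v → Build c 1 (Residue i (λ _ → v))
  constantNode c i v = addNode (nconst (encode ms (constant ms v)))
    (residue 0F λ w → trans (cong (get i) (decode-encode ms (constant ms v))) (get-constant ms i v))

  operation : ∀ {k} → Fin 3 → (x y z : Fin k) → Node A n k
  operation f x y z = napp f (lookup (x ∷ y ∷ z ∷ []))

  value-operation : ∀ {k} (c : Circuit k) f x y z w →
    value (c ▷ operation f x y z) w 0F ≡ apply f (value c w x) (value c w y) (value c w z)
  value-operation c f x y z w = decode-op ms f (lookup (evalCirc A c (encodeBit ms ∘ w)) ∘ lookup (x ∷ y ∷ z ∷ []))

  module _ {k : ℕ} {c : Circuit k} {i : ℕ} where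
    open Modular (maxDigit ms i)
    open ≡-Reasoning

    mulAdd : ∀ {F G H} → Exact (suc i) F c → Residue i G c → Residue i H c →
      Build c 1 (Residue i (λ w → F w * G w + H w))
    mulAdd {F} {G} {H} (exact x X) (residue y Y) (residue z Z) = addNode (operation mulAddOp x y z) (residue 0F λ w → begin
      get i (value (c ▷ operation mulAddOp x y z) w 0F)
        ≡⟨ cong (get i) (value-operation c mulAddOp x y z w) ⟩
      get i (apply mulAddOp (value c w x) (value c w y) (value c w z))
        ≡⟨ get-apply mulAddOp i (value c w x) (value c w y) (value c w z) ⟩
      (get (suc i) (value c w x) * get i (value c w y) + get i (value c w z)) % modulus ms i
        ≡⟨ cong₃ (λ a b d → (a * b + d) % modulus ms i) (X w) (Y w) (Z w) ⟩
      (F w * (G w % modulus ms i) + H w % modulus ms i) % modulus ms i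
        ≡⟨ affine-≈ (0 , 0 , F w) 0 0 (G w % modulus ms i) (G w) (H w % modulus ms i) (H w) refl (%-≈ (G w)) (%-≈ (H w)) ⟩
      (F w * G w + H w) % modulus ms i ∎)

    eqAdd : ∀ {F G H} → Exact (suc i) F c → Exact (suc i) G c → Residue i H c →
      Build c 1 (Residue i (λ w → bit (F w ≡ᵇ G w) + H w))
    eqAdd {F} {G} {H} (exact x X) (exact y Y) (residue z Z) = addNode (operation eqAddOp x y z) (residue 0F λ w → begin
      get i (value (c ▷ operation eqAddOp x y z) w 0F)
        ≡⟨ cong (get i) (value-operation c eqAddOp x y z w) ⟩
      get i (apply eqAddOp (value c w x) (value c w y) (value c w z))
        ≡⟨ get-apply eqAddOp i (value c w x) (value c w y) (value c w z) ⟩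
      (bit (get (suc i) (value c w x) ≡ᵇ get (suc i) (value c w y)) + get i (value c w z)) % modulus ms i
        ≡⟨ cong₃ (λ a b d → (bit (a ≡ᵇ b) + d) % modulus ms i) (X w) (Y w) (Z w) ⟩
      (bit (F w ≡ᵇ G w) + H w % modulus ms i) % modulus ms i
        ≡⟨ +-≈ (bit (F w ≡ᵇ G w)) (bit (F w ≡ᵇ G w)) (H w % modulus ms i) (H w) refl (%-≈ (H w)) ⟩
      (bit (F w ≡ᵇ G w) + H w) % modulus ms i ∎)

  exactConstant : ∀ {k} (c : Circuit k) i v → v < modulus ms i → Build c 1 (Exact i (λ _ → v))
  exactConstant c i v v< = mapWith (λ _ → exact-≗ (λ _ → m<n⇒m%n≡m v<) ∘ residue⇒exact) (constantNode c i v)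

  module EvalABP {q a : ℕ} (abp : ABP q a) (i : ℕ) (β : Input → Fin a → Bool)
    (q≤ : q ≤ modulus ms (suc i)) (2≤ : 2 ≤ modulus ms (suc i))
    {k₀ : ℕ} {c₀ : Circuit k₀} (labels : ∀ l → Exact (suc i) (λ w → bit (β w l)) c₀) where
    open ABP abp using (V; edges)

    Row : ℕ → ∀ {k} → Circuit k → Set
    Row j c = ∀ u → Residue i (λ w → walkSum edges (β w) j u) c

    label : ∀ ℓ {k} {c : Circuit k} → c₀ ⊑ c → Build c 1 (Exact (suc i) (λ w → labelVal (β w) ℓ))
    label (lvar l)   e = weaken z≤n (return (exact-⊑ e (labels l)))
    label (lconst v) e = exactConstant _ (suc i) (toℕ v) (≤-trans (toℕ<n v) q≤)

    step : ∀ j u {k} {c : Circuit k} → c₀ ⊑ c → Row j c → (es : List (Edge q a V)) →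
      Build c (chainCost (length es)) (Residue i (λ w → stepSum edges (β w) j u es))
    step j u e₀ row []       = constantNode _ i 0
    step j u e₀ row (e ∷ es) with Edge.from e ≟ u
    ... | no _  = weaken (m≤m+n _ 2) (step j u e₀ row es)
    ... | yes _ =
      step j u e₀ row es >>= λ e₁ rest →
      label (Edge.label e) (⊑-trans e₀ e₁) >>= λ e₂ ℓ →
      mulAdd ℓ (residue-⊑ (⊑-trans e₁ e₂) (row (Edge.to e))) (residue-⊑ e₂ rest)

    firstRow : ∀ {k} {c : Circuit k} → Build c (walkCost abp 0) (Row 0)
    firstRow = buildAll (suc V) _ _ (λ u → residue-⊑)
      (λ _ u → constantNode _ i (if does (u ≟ fromℕ V) then 1 else 0))

    nextRow : ∀ j {k} {c : Circuit k} → c₀ ⊑ c → Row j c → Build c (rowCost abp) (Row (suc j))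
    nextRow j e₀ row = buildAll (suc V) _ _ (λ u → residue-⊑)
      (λ e u → step j u (⊑-trans e₀ e) (λ v → residue-⊑ e (row v)) edges)

    record Walk (j : ℕ) {k : ℕ} (c : Circuit k) : Set where
      field
        row   : Row j c
        total : Residue i (λ w → sumUpTo j (λ j′ → walkSum edges (β w) j′ 0F)) c

    walk : ∀ j {k} {c : Circuit k} → c₀ ⊑ c → Exact (suc i) (λ _ → 1) c → Build c (walkCost abp j) (Walk j)
    walk zero    e₀ one = mapWith (λ _ row → record { row = row ; total = row 0F }) firstRow
    walk (suc j) e₀ one =
      walk j e₀ one >>= λ e₁ W →
      nextRow j (⊑-trans e₀ e₁) (Walk.row W) >>= λ e₂ row →
      mapWith (λ e₃ total → record { row = λ u → residue-⊑ e₃ (row u) ; total = residue-≗ one-* total })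
        (mulAdd (exact-⊑ (⊑-trans e₁ e₂) one) (row 0F) (residue-⊑ e₂ (Walk.total W)))
      where
      one-* : ∀ w → 1 * walkSum edges (β w) (suc j) 0F + sumUpTo j (λ j′ → walkSum edges (β w) j′ 0F)
                  ≡ sumUpTo (suc j) (λ j′ → walkSum edges (β w) j′ 0F)
      one-* w = cong (_+ sumUpTo j (λ j′ → walkSum edges (β w) j′ 0F)) (*-identityˡ (walkSum edges (β w) (suc j) 0F))

    evalABP : Build c₀ (abpCost abp) (Residue i (λ w → abpVal abp (β w)))
    evalABP = exactConstant c₀ (suc i) 1 2≤ >>= λ e₀ one → mapWith (λ _ → Walk.total) (walk V e₀ one)

  module _ (o : ℕ) {q : ℕ} (T : Fin q → Bool) (q≤ : q ≤ modulus ms (suc o)) {f : Input → ℕ} where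

    indicators : ∀ Q (emb : Fin Q → Fin q) {k} {c : Circuit k} → Residue (suc o) f c →
      Build c (chainCost Q) (Residue o (λ w → ΣFin Q (λ t → bit (T (emb t) ∧ (f w % modulus ms (suc o) ≡ᵇ toℕ (emb t))))))
    indicators zero    emb v = constantNode _ o 0
    indicators (suc Q) emb v with T (emb 0F)
    ... | false = weaken (m≤m+n _ 2) (indicators Q (emb ∘ fsuc) v)
    ... | true  =
      indicators Q (emb ∘ fsuc) v >>= λ e₁ rest →
      exactConstant _ (suc o) (toℕ (emb 0F)) (≤-trans (toℕ<n (emb 0F)) q≤) >>= λ e₂ t →
      eqAdd (exact-⊑ (⊑-trans e₁ e₂) (residue⇒exact v)) t (residue-⊑ e₂ rest)

  threshold : ∀ o {q} (T : Fin q → Bool) → modulus ms (suc o) ≡ q → 2 ≤ modulus ms o →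
    ∀ {f k} {c : Circuit k} → Residue (suc o) f c → Build c (chainCost q) (Exact o (λ w → bit (inT q T (f w))))
  threshold o {suc q} T refl 2≤ {f} v = exact-≗ equation ∘ residue⇒exact <$> indicators o T ≤-refl (suc q) (λ t → t) v
    where
    equation : ∀ w → ΣFin (suc q) (λ t → bit (T t ∧ (f w % suc q ≡ᵇ toℕ t))) % modulus ms o ≡ bit (T (f w mod suc q))
    equation w = begin
      ΣFin (suc q) (λ t → bit (T t ∧ (f w % suc q ≡ᵇ toℕ t))) % modulus ms o
        ≡⟨ cong (λ x → ΣFin (suc q) (λ t → bit (T t ∧ (x ≡ᵇ toℕ t))) % modulus ms o) (toℕ-mod q (f w)) ⟨
      ΣFin (suc q) (λ t → bit (T t ∧ (toℕ (f w mod suc q) ≡ᵇ toℕ t))) % modulus ms o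
        ≡⟨ cong (_% modulus ms o) (indicatorSum T (f w mod suc q)) ⟩
      bit (T (f w mod suc q)) % modulus ms o
        ≡⟨ m<n⇒m%n≡m (≤-trans (bit<2 (T (f w mod suc q))) 2≤) ⟩
      bit (T (f w mod suc q)) ∎
      where open ≡-Reasoning

  gate : ∀ o {p m} (g : Gate p m) (B : Input → Fin m → Bool) →
    2 ≤ modulus ms o → modulus ms (suc o) ≡ p → p ≤ modulus ms (suc (suc o)) → 2 ≤ modulus ms (suc (suc o)) →
    ∀ {k} {c : Circuit k} → (∀ u → Exact (suc (suc o)) (λ w → bit (B w u)) c) →
    Build c (gateCost g) (Exact o (λ w → bit (gateEval g (B w))))
  gate o g B 2≤o M≡p p≤ 2≤ below =
    EvalABP.evalABP (Gate.abp g) (suc o) (λ w l → B w (Gate.wire g l)) p≤ 2≤ (below ∘ Gate.wire g) >>= λ _ v →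
    threshold o (Gate.T g) M≡p 2≤o v

  simulate : ∀ o {qs m} (s : Stack n qs m) → Hosts ms o qs →
    Build [] (stackCost s) (λ c → ∀ u → Exact o (λ w → bit (evalStack s w u)) c)
  simulate o inputs 2≤ = buildAll n _ _ (λ _ → exact-⊑) (λ _ u → addNode (nvar u) (exact 0F λ w → begin
    get o (decode ms (encodeBit ms (w u)))   ≡⟨ cong (get o) (decode-encode ms (constant ms (bit (w u)))) ⟩
    get o (constant ms (bit (w u)))          ≡⟨ get-constant ms o (bit (w u)) ⟩
    bit (w u) % modulus ms o                 ≡⟨ m<n⇒m%n≡m (≤-trans (bit<2 (w u)) 2≤) ⟩
    bit (w u)                                ∎))
    where open ≡-Reasoning
  simulate o (layer p m g s) (2≤ , M≡p , p≤ , hosts) =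
    simulate (suc (suc o)) s hosts >>= λ _ below →
    buildAll m _ _ (λ _ → exact-⊑) (λ e u →
      gate o (g u) (evalStack s) 2≤ M≡p p≤ (hosts⇒2≤ ms (suc (suc o)) _ hosts) (λ v → exact-⊑ e (below v)))

  -- The output of a circuit is its last node, so the output gate is copied there as d(r, r, r) = r.
  module _ {qs : List ℕ} (s : Stack n qs 1) (hosts : Hosts ms 0 qs) where
    private
      sim : Build [] (stackCost s) (λ c → ∀ u → Exact 0 (λ w → bit (evalStack s w u)) c)
      sim = simulate 0 s hosts
      r : Fin (Build.size sim)
      r = Exact.node (Build.result sim 0F)

    outputCircuit : Circuit (suc (Build.size sim))
    outputCircuit = Build.circuit sim ▷ operation dOp r r r

    outputCircuit-size : Build.size sim ≤ stackCost s
    outputCircuit-size = Build.bounded sim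

    outputCircuit-correct : ∀ w → get 0 (decode ms (output A outputCircuit (encodeBit ms ∘ w))) ≡ bit (evalStack s w 0F)
    outputCircuit-correct w = begin
      get 0 (value outputCircuit w 0F)           ≡⟨ cong (get 0) (value-operation (Build.circuit sim) dOp r r r w) ⟩
      get 0 (apply dOp x x x)                    ≡⟨ cong (get 0) (apply-dOp-xyy x x) ⟩
      get 0 x                                    ≡⟨ Exact.holds (Build.result sim 0F) w ⟩
      bit (evalStack s w 0F)                     ∎
      where
      open ≡-Reasoning
      x : Tuple ms
      x = value (Build.circuit sim) w r

cube : ℕ → ℕ
cube x = x * x * x

cube-mono-≤ : ∀ {x y} → x ≤ y → cube x ≤ cube y
cube-mono-≤ x≤y = *-mono-≤ (*-mono-≤ x≤y x≤y) x≤y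

cube-superadditive : ∀ x y → cube x + cube y ≤ cube (x + y)
cube-superadditive x y = ≤-trans (m≤m+n (cube x + cube y) (3 * (x * y * (x + y))))
  (≤-reflexive (solve 2 (λ x y → (x :* x :* x :+ y :* y :* y) :+ con 3 :* (x :* y :* (x :+ y))
                               := (x :+ y) :* (x :+ y) :* (x :+ y)) refl x y))
  where open +-*-Solver

ΣFin-const : ∀ N c → ΣFin N (λ _ → c) ≡ N * c
ΣFin-const zero    c = refl
ΣFin-const (suc N) c = cong (c +_) (ΣFin-const N c)

ΣFin-mono-≤ : ∀ N {f g : Fin N → ℕ} → (∀ i → f i ≤ g i) → ΣFin N f ≤ ΣFin N g
ΣFin-mono-≤ zero    f≤g = z≤n
ΣFin-mono-≤ (suc N) f≤g = +-mono-≤ (f≤g 0F) (ΣFin-mono-≤ N (f≤g ∘ fsuc))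

ΣFin-*ˡ : ∀ N K (f : Fin N → ℕ) → ΣFin N (λ i → K * f i) ≡ K * ΣFin N f
ΣFin-*ˡ zero    K f = sym (*-zeroʳ K)
ΣFin-*ˡ (suc N) K f = trans (cong (K * f 0F +_) (ΣFin-*ˡ N K (f ∘ fsuc))) (sym (*-distribˡ-+ K (f 0F) _))

ΣFin-cube : ∀ N (f : Fin N → ℕ) → ΣFin N (cube ∘ f) ≤ cube (ΣFin N f)
ΣFin-cube zero    f = z≤n
ΣFin-cube (suc N) f = ≤-trans (+-monoʳ-≤ (cube (f 0F)) (ΣFin-cube N (f ∘ fsuc))) (cube-superadditive (f 0F) _)

chainCost-≤ : ∀ l → chainCost l ≤ 2 * suc l
chainCost-≤ zero    = s≤s z≤n
chainCost-≤ (suc l) = ≤-trans (+-monoˡ-≤ 2 (chainCost-≤ l))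
  (≤-reflexive (solve 1 (λ l → con 2 :* (con 1 :+ l) :+ con 2 := con 2 :* (con 2 :+ l)) refl l))
  where open +-*-Solver

module _ {q a : ℕ} (abp : ABP q a) where
  open ABP abp using (V; edges)
  private
    E G : ℕ
    E = length edges
    G = a + abpSize abp

    sucV≤G : suc V ≤ G
    sucV≤G = ≤-trans (m≤m+n (suc V) E) (m≤n+m (abpSize abp) a)

    sucE≤G : suc E ≤ G
    sucE≤G = ≤-trans (+-monoˡ-≤ E (s≤s z≤n)) (m≤n+m (abpSize abp) a)

  rowCost-≤ : rowCost abp ≤ G * (2 * G)
  rowCost-≤ = begin
    ΣFin (suc V) (λ _ → chainCost E)  ≡⟨ ΣFin-const (suc V) (chainCost E) ⟩
    suc V * chainCost E               ≤⟨ *-mono-≤ sucV≤G (≤-trans (chainCost-≤ E) (*-monoʳ-≤ 2 sucE≤G)) ⟩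
    G * (2 * G)                       ∎
    where open ≤-Reasoning

  walkCost-≤ : ∀ j → walkCost abp j ≤ suc j * (G * (2 * G) + 1)
  walkCost-≤ zero    = begin
    ΣFin (suc V) (λ _ → 1)            ≡⟨ trans (ΣFin-const (suc V) 1) (*-identityʳ (suc V)) ⟩
    suc V                             ≤⟨ ≤-trans sucV≤G (≤-trans (m≤m*n G (2 * G) {{nonZeroG}}) (m≤m+n _ 1)) ⟩
    G * (2 * G) + 1                   ≡⟨ +-identityʳ _ ⟨
    1 * (G * (2 * G) + 1)             ∎
    where
    open ≤-Reasoning
    nonZeroG : NonZero (2 * G)
    nonZeroG = >-nonZero (*-mono-≤ {1} {2} (s≤s z≤n) (≤-trans (s≤s z≤n) sucV≤G))
  walkCost-≤ (suc j) = begin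
    walkCost abp j + (rowCost abp + 1)          ≤⟨ +-mono-≤ (walkCost-≤ j) (+-monoˡ-≤ 1 rowCost-≤) ⟩
    suc j * (G * (2 * G) + 1) + (G * (2 * G) + 1) ≡⟨ +-comm (suc j * (G * (2 * G) + 1)) (G * (2 * G) + 1) ⟩
    suc (suc j) * (G * (2 * G) + 1)             ∎
    where open ≤-Reasoning

  abpCost+chainCost-≤ : ∀ Q → q ≤ Q → abpCost abp + chainCost q ≤ (6 + 2 * Q) * cube G
  abpCost+chainCost-≤ Q q≤Q = begin
    1 + walkCost abp V + chainCost q
      ≤⟨ +-mono-≤ (+-monoʳ-≤ 1 (walkCost-≤ V)) (≤-trans (chainCost-≤ q) (*-monoʳ-≤ 2 (s≤s q≤Q))) ⟩
    1 + suc V * (G * (2 * G) + 1) + 2 * suc Q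
      ≤⟨ +-monoˡ-≤ (2 * suc Q) (+-monoʳ-≤ 1 (*-monoˡ-≤ _ sucV≤G)) ⟩
    1 + G * (G * (2 * G) + 1) + 2 * suc Q
      ≡⟨ solve 2 (λ G Q → con 1 :+ G :* (G :* (con 2 :* G) :+ con 1) :+ con 2 :* (con 1 :+ Q)
                       := con 3 :* con 1 :+ G :+ con 2 :* (G :* G :* G) :+ con 2 :* Q :* con 1) refl G Q ⟩
    3 * 1 + G + 2 * cube G + 2 * Q * 1
      ≤⟨ +-mono-≤ (+-mono-≤ (+-mono-≤ (*-monoʳ-≤ 3 1≤G³) G≤G³) ≤-refl) (*-monoʳ-≤ (2 * Q) 1≤G³) ⟩
    3 * cube G + cube G + 2 * cube G + 2 * Q * cube G
      ≡⟨ solve 2 (λ X Q → con 3 :* X :+ X :+ con 2 :* X :+ con 2 :* Q :* X := (con 6 :+ con 2 :* Q) :* X) refl (cube G) Q ⟩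
    (6 + 2 * Q) * cube G                               ∎
    where
    open ≤-Reasoning
    open +-*-Solver
    1≤G : 1 ≤ G
    1≤G = ≤-trans (s≤s z≤n) sucV≤G
    1≤G³ : 1 ≤ cube G
    1≤G³ = cube-mono-≤ 1≤G
    G≤G³ : G ≤ cube G
    G≤G³ = ≤-trans (≤-reflexive (sym (trans (*-identityʳ (G * 1)) (*-identityʳ G)))) (*-mono-≤ (*-monoʳ-≤ G 1≤G) 1≤G)

gateCost-≤ : ∀ Q {p m} (g : Gate p m) → p ≤ Q → gateCost g ≤ (6 + 2 * Q) * cube (gateSize g)
gateCost-≤ Q g = abpCost+chainCost-≤ (Gate.abp g) Q

stackCost-≤ : ∀ Q {n qs m} (s : Stack n qs m) → All (_≤ Q) qs → stackCost s ≤ n + (6 + 2 * Q) * cube (stackSize s)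
stackCost-≤ Q {n} inputs          []            = ≤-trans (≤-reflexive (trans (ΣFin-const n 1) (*-identityʳ n))) (m≤m+n n _)
stackCost-≤ Q {n} (layer p m g s) (p≤Q ∷ qs≤Q) = begin
  stackCost s + ΣFin m (gateCost ∘ g)                        ≤⟨ +-mono-≤ (stackCost-≤ Q s qs≤Q) gates ⟩
  n + K * cube (stackSize s) + K * cube Σsize
    ≡⟨ +-assoc n (K * cube (stackSize s)) (K * cube Σsize) ⟩
  n + (K * cube (stackSize s) + K * cube Σsize)
    ≡⟨ cong (n +_) (*-distribˡ-+ K (cube (stackSize s)) (cube Σsize)) ⟨
  n + K * (cube (stackSize s) + cube Σsize)
    ≡⟨ cong (λ x → n + K * x) (+-comm (cube (stackSize s)) (cube Σsize)) ⟩
  n + K * (cube Σsize + cube (stackSize s))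
    ≤⟨ +-monoʳ-≤ n (*-monoʳ-≤ K (cube-superadditive Σsize (stackSize s))) ⟩
  n + K * cube (Σsize + stackSize s)                         ∎
  where
  open ≤-Reasoning
  K Σsize : ℕ
  K = 6 + 2 * Q
  Σsize = ΣFin m (gateSize ∘ g)
  gates : ΣFin m (gateCost ∘ g) ≤ K * cube Σsize
  gates = begin
    ΣFin m (gateCost ∘ g)                    ≤⟨ ΣFin-mono-≤ m (λ u → gateCost-≤ Q (g u) p≤Q) ⟩
    ΣFin m (λ u → K * cube (gateSize (g u))) ≡⟨ ΣFin-*ˡ m K (cube ∘ gateSize ∘ g) ⟩
    K * ΣFin m (cube ∘ gateSize ∘ g)          ≤⟨ *-monoʳ-≤ K (ΣFin-cube m (gateSize ∘ g)) ⟩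
    K * cube Σsize                           ∎

-- PolyBounded in the normal form f n ≤ c · (1 + n)ᵏ, which is closed under sums and products.
PowerBounded : (ℕ → ℕ) → Set
PowerBounded f = Σ ℕ λ c → Σ ℕ λ k → ∀ n → f n ≤ c * suc n ^ k

*-^-distrib : ∀ x y k → (x * y) ^ k ≡ x ^ k * y ^ k
*-^-distrib x y zero    = refl
*-^-distrib x y (suc k) = trans (cong (x * y *_) (*-^-distrib x y k))
  (solve 4 (λ x y a b → x :* y :* (a :* b) := x :* a :* (y :* b)) refl x y (x ^ k) (y ^ k))
  where open +-*-Solver

suc^-≤ : ∀ n k → suc n ^ k ≤ 2 ^ k * n ^ k + 2 ^ k
suc^-≤ zero    k = ≤-trans (≤-reflexive (^-zeroˡ k)) (≤-trans (m^n>0 2 k) (m≤n+m (2 ^ k) _))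
suc^-≤ (suc n) k = begin
  suc (suc n) ^ k           ≤⟨ ^-monoˡ-≤ k (+-monoˡ-≤ (suc n) (s≤s z≤n)) ⟩
  (suc n + suc n) ^ k       ≡⟨ cong (_^ k) (solve 1 (λ x → x :+ x := con 2 :* x) refl (suc n)) ⟩
  (2 * suc n) ^ k           ≡⟨ *-^-distrib 2 (suc n) k ⟩
  2 ^ k * suc n ^ k         ≤⟨ m≤m+n _ (2 ^ k) ⟩
  2 ^ k * suc n ^ k + 2 ^ k ∎
  where
  open ≤-Reasoning
  open +-*-Solver

polyBounded⇒powerBounded : ∀ {f} → PolyBounded f → PowerBounded f
polyBounded⇒powerBounded {f} (c , k , f≤) = c + c , k , λ n → begin
  f n                           ≤⟨ f≤ n ⟩
  c * n ^ k + c                 ≤⟨ +-mono-≤ (*-monoʳ-≤ c (^-monoˡ-≤ k (n≤1+n n)))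
                                     (≤-trans (≤-reflexive (sym (*-identityʳ c))) (*-monoʳ-≤ c (m^n>0 (suc n) k))) ⟩
  c * suc n ^ k + c * suc n ^ k ≡⟨ *-distribʳ-+ (suc n ^ k) c c ⟨
  (c + c) * suc n ^ k           ∎
  where open ≤-Reasoning

powerBounded⇒polyBounded : ∀ {f} → PowerBounded f → PolyBounded f
powerBounded⇒polyBounded {f} (c , k , f≤) = c * 2 ^ k , k , λ n → begin
  f n                                   ≤⟨ f≤ n ⟩
  c * suc n ^ k                         ≤⟨ *-monoʳ-≤ c (suc^-≤ n k) ⟩
  c * (2 ^ k * n ^ k + 2 ^ k)           ≡⟨ solve 3 (λ c a x → c :* (a :* x :+ a) := c :* a :* x :+ c :* a) refl c (2 ^ k) (n ^ k) ⟩
  c * 2 ^ k * n ^ k + c * 2 ^ k         ∎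
  where
  open ≤-Reasoning
  open +-*-Solver

powerBounded-mono : ∀ {f g} → (∀ n → f n ≤ g n) → PowerBounded g → PowerBounded f
powerBounded-mono f≤g (c , k , g≤) = c , k , λ n → ≤-trans (f≤g n) (g≤ n)

powerBounded-const : ∀ c → PowerBounded (λ _ → c)
powerBounded-const c = c , 0 , λ n → ≤-reflexive (sym (*-identityʳ c))

powerBounded-id : PowerBounded (λ n → n)
powerBounded-id = 1 , 1 , λ n → ≤-trans (n≤1+n n) (≤-reflexive (sym (trans (*-identityˡ _) (*-identityʳ (suc n)))))

powerBounded-+ : ∀ {f g} → PowerBounded f → PowerBounded g → PowerBounded (λ n → f n + g n)
powerBounded-+ {f} {g} (c , k , f≤) (d , l , g≤) = c + d , k + l , λ n → begin
  f n + g n                                 ≤⟨ +-mono-≤ (f≤ n) (g≤ n) ⟩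
  c * suc n ^ k + d * suc n ^ l             ≤⟨ +-mono-≤ (*-monoʳ-≤ c (^-monoʳ-≤ (suc n) (m≤m+n k l)))
                                                        (*-monoʳ-≤ d (^-monoʳ-≤ (suc n) (m≤n+m l k))) ⟩
  c * suc n ^ (k + l) + d * suc n ^ (k + l) ≡⟨ *-distribʳ-+ (suc n ^ (k + l)) c d ⟨
  (c + d) * suc n ^ (k + l)                 ∎
  where open ≤-Reasoning

powerBounded-* : ∀ {f g} → PowerBounded f → PowerBounded g → PowerBounded (λ n → f n * g n)
powerBounded-* {f} {g} (c , k , f≤) (d , l , g≤) = c * d , k + l , λ n → begin
  f n * g n                                 ≤⟨ *-mono-≤ (f≤ n) (g≤ n) ⟩
  c * suc n ^ k * (d * suc n ^ l)           ≡⟨ solve 4 (λ c d x y → c :* x :* (d :* y) := c :* d :* (x :* y)) refl c d (suc n ^ k) (suc n ^ l) ⟩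
  c * d * (suc n ^ k * suc n ^ l)           ≡⟨ cong (c * d *_) (^-distribˡ-+-* (suc n) k l) ⟨
  c * d * suc n ^ (k + l)                   ∎
  where
  open ≤-Reasoning
  open +-*-Solver

layout : ℕ → List ℕ → List ℕ
layout r []       = r ∷ []
layout r (q ∷ qs) = r ∷ pred q ∷ layout q qs

maxDigit-layout : ∀ r qs → maxDigit (layout r qs) 0 ≡ r
maxDigit-layout r []       = refl
maxDigit-layout r (q ∷ qs) = refl

hosts-shift : ∀ a b ms o qs → Hosts ms o qs → Hosts (a ∷ b ∷ ms) (suc (suc o)) qs
hosts-shift a b ms o []       h                    = h
hosts-shift a b ms o (q ∷ qs) (h₁ , h₂ , h₃ , h) = h₁ , h₂ , h₃ , hosts-shift a b ms (suc (suc o)) qs h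

layout-hosts : ∀ r qs → 1 ≤ r → All NonZero qs → Hosts (layout r qs) 0 qs
layout-hosts r []       1≤r []         = s≤s 1≤r
layout-hosts r (q ∷ qs) 1≤r (q≢0 ∷ qs≢0) =
  s≤s 1≤r , suc-pred q {{q≢0}} , ≤-trans (n≤1+n q) (s≤s (≤-reflexive (sym (maxDigit-layout q qs)))) ,
  hosts-shift r (pred q) (layout q qs) 0 qs (layout-hosts q qs (>-nonZero⁻¹ q {{q≢0}}) qs≢0)

all-≤-sum : ∀ qs → All (_≤ sum qs) qs
all-≤-sum []       = []
all-≤-sum (q ∷ qs) = m≤m+n q (sum qs) ∷ All.map (λ {x} x≤ → ≤-trans x≤ (m≤n+m (sum qs) q)) (all-≤-sum qs)

bit-≡ᵇ-1 : ∀ b → (bit b ≡ᵇ 1) ≡ b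
bit-≡ᵇ-1 false = refl
bit-≡ᵇ-1 true  = refl

nuDet⊆nuP : ∀ ms {p ps} → Hosts ms 0 (p ∷ ps) → ∀ Q → All (_≤ Q) (p ∷ ps) →
  ∀ L → InNuDet p ps L → InNuP (algebra ms) L
nuDet⊆nuP ms hosts Q qs≤Q L (C , C-poly , C-correct) = circuit , encodeBit ms , accept , circuit-poly , circuit-correct
  where
  open Simulation ms using (outputCircuit; outputCircuit-size; outputCircuit-correct)

  circuit : (n : ℕ) → Σ ℕ λ s → Circ (algebra ms) n (suc s)
  circuit n = _ , outputCircuit n (C n) hosts

  accept : Fin (card ms) → Bool
  accept x = get 0 (decode ms x) ≡ᵇ 1

  K : ℕ
  K = 6 + 2 * Q

  circuit-size : ∀ n → suc (proj₁ (circuit n)) ≤ 1 + (n + K * cube (stackSize (C n)))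
  circuit-size n = s≤s (≤-trans (outputCircuit-size n (C n) hosts) (stackCost-≤ Q (C n) qs≤Q))

  circuit-poly : PolyBounded (λ n → suc (proj₁ (circuit n)))
  circuit-poly = powerBounded⇒polyBounded (powerBounded-mono circuit-size
    (powerBounded-+ (powerBounded-const 1) (powerBounded-+ powerBounded-id
      (powerBounded-* (powerBounded-const K) (powerBounded-* (powerBounded-* S S) S)))))
    where
    S : PowerBounded (λ n → stackSize (C n))
    S = polyBounded⇒powerBounded C-poly

  circuit-correct : ∀ n w → L n w ⇔ (accept (output (algebra ms) (proj₂ (circuit n)) (λ i → encodeBit ms (w i))) ≡ true)
  circuit-correct n w = ⇔-trans (C-correct n w) (mk⇔ (trans accepts) (trans (sym accepts)))
    where
    accepts : accept (output (algebra ms) (proj₂ (circuit n)) (λ i → encodeBit ms (w i))) ≡ evalStack (C n) w 0F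
    accepts = trans (cong (_≡ᵇ 1) (outputCircuit-correct n (C n) hosts w)) (bit-≡ᵇ-1 _)

mainTheorem7 : (p : ℕ) (ps : List ℕ) → All Prime (p ∷ ps) →
    Σ FinAlg λ A → Malcev A × Solvable A × ((L : Lang) → InNuDet p ps L → InNuP A L)
mainTheorem7 p ps primes = algebra ms , algebra-malcev ms , algebra-solvable ms ,
  nuDet⊆nuP ms (layout-hosts 1 (p ∷ ps) ≤-refl (All.map prime⇒nonZero primes)) (sum (p ∷ ps)) (all-≤-sum (p ∷ ps))
  where
  ms : List ℕ
  ms = layout 1 (p ∷ ps)
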